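{- Let $\Gamma$ be a metrized graph with $v=\#V(\Gamma)\ge2$ vertices. Then $N(\Gamma)=\Lambda(\Gamma)$.
   Context: A metrized graph is a finite connected graph (multiple edges and self-loops allowed) whose edges are identified with closed segments of positive lengths; its vertex set $V(\Gamma)$ is finite, nonempty and contains all points of valence $\neq2$. $\Lambda(\Gamma)$ is the edge connectivity (minimum number of edges whose deletion disconnects $\Gamma$). Contracting an edge means shrinking it to a single point (identifying its endpoints and removing the edge). An admissible contraction of $\Gamma$ is a graph obtained by successively contracting $v-2$ edges $e_{i_1},\dots,e_{i_{v-2}}$, each having distinct endpoints in the current graph, so that the resulting graph has exactly $2$ vertices $p,q$; it then consists of $n'=n(i_1,\dots,i_{v-2})$ parallel edges between $p$ and $q$ together with possibly some self-loops. $N(\Gamma)$ is the minimum of $n'$ over all admissible contractions of $\Gamma$. -}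

module Defs where

open import Data.Nat using (ℕ; zero; suc; _≤_)
open import Data.Fin using (Fin; punchIn; punchOut; _≟_)
open import Data.Fin.Subset using (Subset; _∈_; _∉_; ∣_∣)
open import Data.Product using (_×_; _,_; proj₁; proj₂; Σ)
open import Data.List using (List; filter; length; allFin)
open import Relation.Nullary using (¬_; yes; no)
open import Relation.Binary.PropositionalEquality using (_≡_; _≢_; refl; sym)

-- A finite multigraph (self-loops and multiple edges allowed) with
-- vertex set Fin v and edge set Fin e; each edge has two endpoints.
-- (Edge lengths of the metrized graph play no role in N or Λ.)
Graph : ℕ → ℕ → Set
Graph v e = Fin e → Fin v × Fin v

src tgt : ∀ {v e} → Graph v e → Fin e → Fin v
src G j = proj₁ (G j)
tgt G j = proj₂ (G j)

data Reach {v e} (G : Graph v e) (S : Subset e) : Fin v → Fin v → Set where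
  here : ∀ {x} → Reach G S x x
  fwd  : ∀ {y} (j : Fin e) → j ∉ S → Reach G S (tgt G j) y → Reach G S (src G j) y
  bwd  : ∀ {y} (j : Fin e) → j ∉ S → Reach G S (src G j) y → Reach G S (tgt G j) y

ConnectedWithout : ∀ {v e} → Graph v e → Subset e → Set
ConnectedWithout G S = ∀ x y → Reach G S x y

Connected : ∀ {v e} → Graph v e → Set
Connected G = ConnectedWithout G Data.Fin.Subset.⊥

DisconnectingOfSize : ∀ {v e} → Graph v e → ℕ → Set
DisconnectingOfSize {e = e} G k =
  Σ (Subset e) λ S → ∣ S ∣ ≡ k × ¬ ConnectedWithout G S

IsMin : (ℕ → Set) → ℕ → Set
IsMin P k = P k × (∀ j → P j → k ≤ j)

-- Contract edge i (with distinct endpoints a = src, b = tgt): vertex b is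
-- identified with a (vertices renumbered by punchOut b), edge i is removed
-- (remaining edges renumbered by punchIn i).
mergeV : ∀ {n} (a b : Fin (suc n)) → a ≢ b → Fin (suc n) → Fin n
mergeV a b a≢b x with b ≟ x
... | yes _   = punchOut {i = b} {j = a} (λ b≡a → a≢b (sym b≡a))
... | no b≢x = punchOut {i = b} {j = x} b≢x

contract : ∀ {n e} (G : Graph (suc n) (suc e)) (i : Fin (suc e)) →
           src G i ≢ tgt G i → Graph n e
contract G i ne j =
  mergeV (src G i) (tgt G i) ne (src G (punchIn i j)) ,
  mergeV (src G i) (tgt G i) ne (tgt G (punchIn i j))

-- number of non-loop edges, i.e. for a graph on two vertices p,q the
-- number of parallel edges between p and q
nonLoops : ∀ {v e} → Graph v e → ℕ
nonLoops G = length (filter (λ j → ¬? (src G j ≟ tgt G j)) (allFin _))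
  where open import Relation.Nullary using (¬?)

-- Adm G n' : some admissible contraction of G (successive contractions of
-- edges with distinct endpoints down to exactly 2 vertices) has n'
-- parallel edges between its two vertices.
data Adm : ∀ {v e} → Graph v e → ℕ → Set where
  done : ∀ {e} (G : Graph 2 e) → Adm G (nonLoops G)
  step : ∀ {n e m} (G : Graph (suc (suc (suc n))) (suc e)) (i : Fin (suc e))
         (ne : src G i ≢ tgt G i) → Adm (contract G i ne) m → Adm G m

module Submission where

-- Both sides are governed by CUTS: the cut of a non-constant
-- 2-colouring f of the vertices is the set of edges joining different colours.
--   * N ≥ Λ: pulling the colouring of the final two vertices back along the
--     contractions, an admissible contraction with n' edges is a cut of size
--     n', and every cut disconnects the graph.
--   * N ≤ Λ: in a connected graph every cut bounds an admissible contraction: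
--     contract monochromatic links while possible (the colouring descends with
--     the same cut); if every link crosses f, switch to the indicator of a
--     vertex off some link, whose cut is no larger.
--   * A disconnecting set S contains the cut of "reachable from x₀ without S".
--     Reachability is not decided here, so this holds only under ¬¬; as the
--     conclusion k ≤ |S| is decidable, that suffices.
--   * Admissibility is decidable, so the least admissible value exists.

open import Defs
open import Data.Nat using (ℕ; _≤_)
open import Data.Product using (_×_; ∃-syntax)

import Data.Nat as ℕ
open import Data.Nat using (suc; _+_; _<_; _≤?_; s≤s)
open import Data.Nat.Properties
  using (≤-refl; ≤-trans; ≤-reflexive; ≮⇒≥; +-suc; +-identityʳ; m<1+n⇒m<n∨m≡n)
open import Data.Bool using (Bool; true; false; not)
import Data.Bool as Bool
open import Data.Fin using (Fin; zero; suc; punchIn; punchOut; _≟_)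
open import Data.Fin.Properties
  using (punchOut-cong; punchIn-punchOut; punchOut-punchIn; punchInᵢ≢i;
         punchIn-injective; any?; all?; ¬∀⟶∃¬)
open import Data.Fin.Subset using (Subset; _∈_; _∉_; _⊆_; ∣_∣) renaming (⊥ to ∅)
open import Data.Fin.Subset.Properties using (∉⊥; _∈?_; p⊆q⇒∣p∣≤∣q∣)
open import Data.Vec.Base using (_∷_; tabulate)
open import Data.Vec.Properties using ([]=↔lookup; lookup∘tabulate; tabulate-cong)
import Data.List as List
open import Data.List using (filter; length)
open import Data.Product using (Σ; _,_; proj₁; proj₂)
open import Data.Sum using (_⊎_; inj₁; inj₂)
open import Function using (_∘_)
open import Function.Bundles using (Inverse)
open import Relation.Nullary using (¬_; Dec; yes; no; does; ¬?; contradiction)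
open import Relation.Nullary.Decidable
  using (dec-true; dec-false; decidable-stable; _×-dec_; ¬¬-excluded-middle)
open import Relation.Nullary.Negation using (¬¬-map)
open import Relation.Unary using (Decidable)
open import Relation.Binary.Definitions using (DecidableEquality)
open import Relation.Binary.PropositionalEquality
  using (_≡_; _≢_; _≗_; refl; sym; trans; cong; cong₂; subst; subst₂)

differ : ∀ {A : Set} → DecidableEquality A → A → A → Bool
differ _≟_ x y = does (¬? (x ≟ y))

module _ {A : Set} (_≟ᴬ_ : DecidableEquality A) {x y : A} where

  differ-≢ : x ≢ y → differ _≟ᴬ_ x y ≡ true
  differ-≢ x≢y = cong not (dec-false (x ≟ᴬ y) x≢y)

  differ-≡ : x ≡ y → differ _≟ᴬ_ x y ≡ false
  differ-≡ x≡y = cong not (dec-true (x ≟ᴬ y) x≡y)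

  differ-true⇒≢ : differ _≟ᴬ_ x y ≡ true → x ≢ y
  differ-true⇒≢ d x≡y with () ← trans (sym d) (differ-≡ x≡y)

  differ-false⇒≡ : differ _≟ᴬ_ x y ≡ false → x ≡ y
  differ-false⇒≡ d with x ≟ᴬ y
  ... | yes x≡y = x≡y
  differ-false⇒≡ () | no _

differ-injective : ∀ {A B : Set} (_≟ᴬ_ : DecidableEquality A) (_≟ᴮ_ : DecidableEquality B)
  (f : A → B) → (∀ x y → f x ≡ f y → x ≡ y) → ∀ x y →
  differ _≟ᴮ_ (f x) (f y) ≡ differ _≟ᴬ_ x y
differ-injective _≟ᴬ_ _≟ᴮ_ f inj x y with x ≟ᴬ y
... | yes refl = differ-≡ _≟ᴮ_ refl
... | no x≢y = differ-≢ _≟ᴮ_ (x≢y ∘ inj x y)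

∈-tabulate⁺ : ∀ {e} (p : Fin e → Bool) {j} → p j ≡ true → j ∈ tabulate p
∈-tabulate⁺ p {j} pj = Inverse.from []=↔lookup (trans (lookup∘tabulate p j) pj)

∈-tabulate⁻ : ∀ {e} (p : Fin e → Bool) {j} → j ∈ tabulate p → p j ≡ true
∈-tabulate⁻ p {j} j∈ = trans (sym (lookup∘tabulate p j)) (Inverse.to []=↔lookup j∈)

tabulate-⊆ : ∀ {e} (p q : Fin e → Bool) → (∀ j → p j ≡ true → q j ≡ true) →
  tabulate p ⊆ tabulate q
tabulate-⊆ p q p⇒q {j} j∈p = ∈-tabulate⁺ q (p⇒q j (∈-tabulate⁻ p j∈p))

∣∷∣-cong : ∀ {e e′} b (S : Subset e) (T : Subset e′) → ∣ S ∣ ≡ ∣ T ∣ → ∣ b ∷ S ∣ ≡ ∣ b ∷ T ∣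
∣∷∣-cong true _ _ = cong suc
∣∷∣-cong false _ _ eq = eq

-- Removing an element outside the subset does not change its size;
-- this is how the size of a cut survives contracting a non-crossing edge.
∣tabulate∣-punchIn : ∀ {e} (p : Fin (suc e) → Bool) (i : Fin (suc e)) → p i ≡ false →
  ∣ tabulate p ∣ ≡ ∣ tabulate (p ∘ punchIn i) ∣
∣tabulate∣-punchIn p zero p0 rewrite p0 = refl
∣tabulate∣-punchIn {suc e} p (suc i) pi =
  ∣∷∣-cong (p zero) (tabulate (p ∘ suc)) (tabulate (p ∘ suc ∘ punchIn i))
    (∣tabulate∣-punchIn (p ∘ suc) i pi)

length-filter : ∀ {A : Set} {P : A → Set} (P? : Decidable P) {e} (g : Fin e → A) →
  length (filter P? (List.tabulate g)) ≡ ∣ tabulate (does ∘ P? ∘ g) ∣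
length-filter P? {ℕ.zero} g = refl
length-filter P? {suc e} g with does (P? (g zero))
... | true = cong suc (length-filter P? (g ∘ suc))
... | false = length-filter P? (g ∘ suc)

reach-trans : ∀ {v e} {G : Graph v e} {S x y z} →
  Reach G S x y → Reach G S y z → Reach G S x z
reach-trans here r = r
reach-trans (fwd j j∉S r) r′ = fwd j j∉S (reach-trans r r′)
reach-trans (bwd j j∉S r) r′ = bwd j j∉S (reach-trans r r′)

reach-invariant : ∀ {v e} {A : Set} {G : Graph v e} {S} (f : Fin v → A) →
  (∀ j → j ∉ S → f (src G j) ≡ f (tgt G j)) → ∀ {x y} → Reach G S x y → f x ≡ f y
reach-invariant f inv here = refl
reach-invariant f inv (fwd j j∉S r) = trans (inv j j∉S) (reach-invariant f inv r)
reach-invariant f inv (bwd j j∉S r) = trans (sym (inv j j∉S)) (reach-invariant f inv r)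

Link : ∀ {v e} → Graph v e → Fin e → Set
Link G j = src G j ≢ tgt G j

path-link : ∀ {v e} {G : Graph v e} {S x y} → Reach G S x y → x ≢ y → Σ (Fin e) (Link G)
path-link here x≢x = contradiction refl x≢x
path-link {G = G} (fwd j _ r) x≢y with src G j ≟ tgt G j
... | yes s≡t = path-link r (x≢y ∘ trans s≡t)
... | no s≢t = j , s≢t
path-link {G = G} (bwd j _ r) x≢y with src G j ≟ tgt G j
... | yes s≡t = path-link r (x≢y ∘ trans (sym s≡t))
... | no s≢t = j , s≢t

connected-link : ∀ {n e} (G : Graph (suc (suc n)) e) → Connected G → Σ (Fin e) (Link G)
connected-link G conn = path-link (conn zero (suc zero)) (λ ())

Colouring : ℕ → Set
Colouring v = Fin v → Bool

Nonconstant : ∀ {v} → Colouring v → Set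
Nonconstant {v} f = Σ (Fin v) λ x → Σ (Fin v) λ y → f x ≡ true × f y ≡ false

crosses : ∀ {v e} → Graph v e → Colouring v → Fin e → Bool
crosses G f j = differ Bool._≟_ (f (src G j)) (f (tgt G j))

cut : ∀ {v e} → Graph v e → Colouring v → Subset e
cut G f = tabulate (crosses G f)

nonLoops-links : ∀ {v e} (G : Graph v e) →
  nonLoops G ≡ ∣ tabulate (λ j → differ _≟_ (src G j) (tgt G j)) ∣
nonLoops-links G = length-filter (λ j → ¬? (src G j ≟ tgt G j)) (λ j → j)

crossing-link : ∀ {v e} (G : Graph v e) (f : Colouring v) {j} → crosses G f j ≡ true → Link G j
crossing-link G f c s≡t = differ-true⇒≢ Bool._≟_ c (cong f s≡t)

cut-disconnects : ∀ {v e} (G : Graph v e) (f : Colouring v) → Nonconstant f →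
  ¬ ConnectedWithout G (cut G f)
cut-disconnects G f (x , y , fx , fy) conn =
  contradiction (trans (sym fx) (trans (reach-invariant f uncut (conn x y)) fy)) λ ()
  where
  uncut : ∀ j → j ∉ cut G f → f (src G j) ≡ f (tgt G j)
  uncut j j∉cut with crosses G f j in c
  ... | true = contradiction (∈-tabulate⁺ (crosses G f) c) j∉cut
  ... | false = differ-false⇒≡ Bool._≟_ c

links-cross⇒cut-maximal : ∀ {v e} (G : Graph v e) (f g : Colouring v) →
  (∀ j → Link G j → crosses G f j ≡ true) → ∣ cut G g ∣ ≤ ∣ cut G f ∣
links-cross⇒cut-maximal G f g all-cross = p⊆q⇒∣p∣≤∣q∣
  (tabulate-⊆ (crosses G g) (crosses G f) (λ j c → all-cross j (crossing-link G g c)))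

injective₂ : (f : Colouring 2) → Nonconstant f → ∀ x y → f x ≡ f y → x ≡ y
injective₂ f nc zero zero _ = refl
injective₂ f nc (suc zero) (suc zero) _ = refl
injective₂ f nc (suc zero) zero eq = sym (injective₂ f nc zero (suc zero) (sym eq))
injective₂ f (x , y , fx , fy) zero (suc zero) eq =
  contradiction (trans (sym fx) (trans (flat x) (trans (sym (flat y)) fy))) λ ()
  where
  flat : ∀ z → f z ≡ f zero
  flat zero = refl
  flat (suc zero) = sym eq

nonLoops-cut : ∀ {e} (G : Graph 2 e) (f : Colouring 2) → Nonconstant f →
  nonLoops G ≡ ∣ cut G f ∣
nonLoops-cut G f nc = trans (nonLoops-links G) (sym (cong ∣_∣ (tabulate-cong λ j →
  differ-injective _≟_ Bool._≟_ f (injective₂ f nc) (src G j) (tgt G j))))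

c₀ : ∀ {n} → Colouring (suc (suc n))
c₀ zero = true
c₀ (suc _) = false

c₀-nonconstant : ∀ {n} → Nonconstant (c₀ {n})
c₀-nonconstant = zero , suc zero , refl , refl

mergeV-ab : ∀ {n} (a b : Fin (suc n)) (a≢b : a ≢ b) → mergeV a b a≢b a ≡ mergeV a b a≢b b
mergeV-ab a b a≢b with b ≟ a | b ≟ b
... | yes b≡a | _ = contradiction (sym b≡a) a≢b
... | no _ | yes _ = punchOut-cong b refl
... | no _ | no b≢b = contradiction refl b≢b

mergeV-punchIn : ∀ {n} (a b : Fin (suc n)) (a≢b : a ≢ b) y → mergeV a b a≢b (punchIn b y) ≡ y
mergeV-punchIn a b a≢b y with b ≟ punchIn b y
... | yes b≡y = contradiction (sym b≡y) (punchInᵢ≢i b y)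
... | no _ = trans (punchOut-cong b refl) (punchOut-punchIn b)

punchIn-mergeV : ∀ {n} (a b : Fin (suc n)) (a≢b : a ≢ b) x →
  punchIn b (mergeV a b a≢b x) ≡ x ⊎ (x ≡ b × punchIn b (mergeV a b a≢b x) ≡ a)
punchIn-mergeV a b a≢b x with b ≟ x
... | yes refl = inj₂ (refl , punchIn-punchOut _)
... | no b≢x = inj₁ (punchIn-punchOut b≢x)

mergeV-cong : ∀ {n} {a a′ b b′ x x′ : Fin (suc n)} (a≢b : a ≢ b) (a′≢b′ : a′ ≢ b′) →
  a ≡ a′ → b ≡ b′ → x ≡ x′ → mergeV a b a≢b x ≡ mergeV a′ b′ a′≢b′ x′
mergeV-cong {b = b} {x = x} _ _ refl refl refl with b ≟ x
... | yes _ = punchOut-cong b refl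
... | no _ = punchOut-cong b refl

contract-resp-≗ : ∀ {n e} {G G′ : Graph (suc n) (suc e)} (i : Fin (suc e))
  (ne : Link G i) (ne′ : Link G′ i) → G ≗ G′ → contract G i ne ≗ contract G′ i ne′
contract-resp-≗ i ne ne′ G≗G′ j = cong₂ _,_ (merged proj₁) (merged proj₂)
  where
  merged = λ end → mergeV-cong ne ne′ (cong proj₁ (G≗G′ i)) (cong proj₂ (G≗G′ i))
                                      (cong end (G≗G′ (punchIn i j)))

module Contraction {n e} (G : Graph (suc n) (suc e)) (i : Fin (suc e)) (ne : Link G i) where

  H : Graph n e
  H = contract G i ne

  merge : Fin (suc n) → Fin n
  merge = mergeV (src G i) (tgt G i) ne

  edge-cases : ∀ j → i ≡ j ⊎ Σ (Fin e) λ j′ → punchIn i j′ ≡ j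
  edge-cases j with i ≟ j
  ... | yes i≡j = inj₁ i≡j
  ... | no i≢j = inj₂ (punchOut i≢j , punchIn-punchOut i≢j)

  reach-merge : ∀ {x y} → Reach G ∅ x y → Reach H ∅ (merge x) (merge y)
  reach-merge here = here
  reach-merge {y = y} (fwd j _ r) with edge-cases j
  ... | inj₁ refl = subst (λ z → Reach H ∅ z (merge y)) (sym (mergeV-ab _ _ ne)) (reach-merge r)
  ... | inj₂ (j′ , refl) = fwd j′ ∉⊥ (reach-merge r)
  reach-merge {y = y} (bwd j _ r) with edge-cases j
  ... | inj₁ refl = subst (λ z → Reach H ∅ z (merge y)) (mergeV-ab _ _ ne) (reach-merge r)
  ... | inj₂ (j′ , refl) = bwd j′ ∉⊥ (reach-merge r)

  connected : Connected G → Connected H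
  connected conn x y = subst₂ (Reach H ∅) (mergeV-punchIn _ _ ne x) (mergeV-punchIn _ _ ne y)
    (reach-merge (conn (punchIn (tgt G i) x) (punchIn (tgt G i) y)))

  -- Colourings of H lift to G; edge i does not cross the lift, and the
  -- other edges cross exactly when they cross in H.
  lift : Colouring n → Colouring (suc n)
  lift g = g ∘ merge

  cut-lift : (g : Colouring n) → ∣ cut G (lift g) ∣ ≡ ∣ cut H g ∣
  cut-lift g = ∣tabulate∣-punchIn (crosses G (lift g)) i
    (differ-≡ Bool._≟_ (cong g (mergeV-ab _ _ ne)))

  nonconstant-lift : (g : Colouring n) → Nonconstant g → Nonconstant (lift g)
  nonconstant-lift g (x , y , gx , gy) = punchIn (tgt G i) x , punchIn (tgt G i) y ,
    trans (cong g (mergeV-punchIn _ _ ne x)) gx , trans (cong g (mergeV-punchIn _ _ ne y)) gy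

  restrict : Colouring (suc n) → Colouring n
  restrict f = f ∘ punchIn (tgt G i)

  lift-restrict : (f : Colouring (suc n)) → f (src G i) ≡ f (tgt G i) → lift (restrict f) ≗ f
  lift-restrict f mono x with punchIn-mergeV _ _ ne x
  ... | inj₁ same = cong f same
  ... | inj₂ (refl , moved) = trans (cong f moved) mono

  cut-restrict : (f : Colouring (suc n)) → f (src G i) ≡ f (tgt G i) →
    ∣ cut G f ∣ ≡ ∣ cut H (restrict f) ∣
  cut-restrict f mono = trans
    (cong ∣_∣ (tabulate-cong λ j → sym (cong₂ (differ Bool._≟_)
      (lift-restrict f mono (src G j)) (lift-restrict f mono (tgt G j)))))
    (cut-lift (restrict f))

  nonconstant-restrict : (f : Colouring (suc n)) → f (src G i) ≡ f (tgt G i) →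
    Nonconstant f → Nonconstant (restrict f)
  nonconstant-restrict f mono (x , y , fx , fy) = merge x , merge y ,
    trans (lift-restrict f mono x) fx , trans (lift-restrict f mono y) fy

-- N ≥ Λ: pulling the colouring of the final two vertices back along the
-- contractions, an admissible contraction with m edges is a cut of size m ...
contraction⇒cut : ∀ {v e} {G : Graph v e} {m} → Adm G m →
  Σ (Colouring v) λ f → Nonconstant f × ∣ cut G f ∣ ≡ m
contraction⇒cut (done G) = c₀ , c₀-nonconstant , sym (nonLoops-cut G c₀ c₀-nonconstant)
contraction⇒cut (step G i ne adm) with contraction⇒cut adm
... | g , nc , size = lift g , nonconstant-lift g nc , trans (cut-lift g) size
  where open Contraction G i ne

contraction⇒disconnecting : ∀ {v e} {G : Graph v e} {m} → Adm G m → DisconnectingOfSize G m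
contraction⇒disconnecting {G = G} adm with contraction⇒cut adm
... | f , nc , size = cut G f , size , cut-disconnects G f nc

third-vertex : ∀ {n} (a b : Fin (suc (suc (suc n)))) → a ≢ b →
  Σ (Fin (suc (suc (suc n)))) λ w → w ≢ a × w ≢ b
third-vertex a b a≢b = punchIn a c , punchInᵢ≢i a c ,
  λ w≡b → punchInᵢ≢i b′ zero
    (punchIn-injective a _ _ (trans w≡b (sym (punchIn-punchOut a≢b))))
  where
  b′ = punchOut a≢b
  c = punchIn b′ zero

singleton : ∀ {v} → Fin v → Colouring v
singleton w x = does (w ≟ x)

monochromatic-link : ∀ {n e} (G : Graph (suc (suc (suc n))) e) → Connected G →
  (f : Colouring (suc (suc (suc n)))) → Nonconstant f →
  Σ (Colouring (suc (suc (suc n)))) λ f′ → Nonconstant f′ × ∣ cut G f′ ∣ ≤ ∣ cut G f ∣ ×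
    Σ (Fin e) λ i → Link G i × f′ (src G i) ≡ f′ (tgt G i)
monochromatic-link G conn f nc
  with any? (λ i → ¬? (src G i ≟ tgt G i) ×-dec (f (src G i) Bool.≟ f (tgt G i)))
... | yes (i , ne , mono) = f , nc , ≤-refl , i , ne , mono
... | no none with connected-link G conn
...   | i , ne with third-vertex (src G i) (tgt G i) ne
...     | w , w≢s , w≢t =
  singleton w , (w , src G i , dec-true (w ≟ w) refl , dec-false (w ≟ src G i) w≢s) ,
  links-cross⇒cut-maximal G f (singleton w)
    (λ j link → differ-≢ Bool._≟_ (λ mono → none (j , link , mono))) ,
  i , ne , trans (dec-false (w ≟ src G i) w≢s) (sym (dec-false (w ≟ tgt G i) w≢t))

-- Induction on the number
-- of vertices: on two vertices the cut consists of all links; otherwise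
-- contract a monochromatic link, whose colouring descends with the same cut.
contraction≤cut : ∀ {n e} (G : Graph (suc (suc n)) e) → Connected G →
  (f : Colouring (suc (suc n))) → Nonconstant f → Σ ℕ λ m → m ≤ ∣ cut G f ∣ × Adm G m
contraction≤cut {ℕ.zero} G _ f nc = nonLoops G , ≤-reflexive (nonLoops-cut G f nc) , done G
contraction≤cut {suc n} {ℕ.zero} G conn f nc with connected-link G conn
... | () , _
contraction≤cut {suc n} {suc e} G conn f nc with monochromatic-link G conn f nc
... | f′ , nc′ , f′≤f , i , ne , mono =
  let m , m≤cut , adm = contraction≤cut C.H (C.connected conn) (C.restrict f′)
                                        (C.nonconstant-restrict f′ mono nc′)
  in m , ≤-trans m≤cut (≤-trans (≤-reflexive (sym (C.cut-restrict f′ mono))) f′≤f) ,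
     step G i ne adm
  where module C = Contraction G i ne

¬¬-∀-Fin : ∀ {n} {P : Fin n → Set} → (∀ i → ¬ ¬ P i) → ¬ ¬ (∀ i → P i)
¬¬-∀-Fin {ℕ.zero} _ ¬all = ¬all (λ ())
¬¬-∀-Fin {suc n} {P} ¬¬P ¬all = ¬¬P zero λ p₀ →
  ¬¬-∀-Fin (¬¬P ∘ suc) λ ps → ¬all λ { zero → p₀ ; (suc i) → ps i }

-- Colouring each vertex by reachability from a vertex x₀ that cannot reach
-- everything, every crossing edge must be deleted.
disconnecting⇒cut : ∀ {v e} (G : Graph v e) (S : Subset e) → ¬ ConnectedWithout G S →
  ¬ ¬ (Σ (Colouring v) λ f → Nonconstant f × cut G f ⊆ S)
disconnecting⇒cut G S disc =
  ¬¬-map component (¬¬-∀-Fin λ x → ¬¬-∀-Fin λ y → ¬¬-excluded-middle)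
  where
  component : (∀ x y → Dec (Reach G S x y)) → Σ (Colouring _) λ f → Nonconstant f × cut G f ⊆ S
  component reach? with ¬∀⟶∃¬ _ _ (λ x → all? (reach? x)) disc
  ... | x₀ , ¬all with ¬∀⟶∃¬ _ _ (reach? x₀) ¬all
  ... | y₀ , ¬reach = f , (x₀ , y₀ , dec-true (reach? x₀ x₀) here , dec-false (reach? x₀ y₀) ¬reach) ,
                      λ {j} j∈cut → kept j (∈-tabulate⁻ (crosses G f) j∈cut)
    where
    f : Colouring _
    f y = does (reach? x₀ y)

    same-side : ∀ j → j ∉ S → f (src G j) ≡ f (tgt G j)
    same-side j j∉S with reach? x₀ (src G j) | reach? x₀ (tgt G j)
    ... | yes _ | yes _ = refl
    ... | no _ | no _ = refl
    ... | yes r | no ¬r = contradiction (reach-trans r (fwd j j∉S here)) ¬r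
    ... | no ¬r | yes r = contradiction (reach-trans r (bwd j j∉S here)) ¬r

    kept : ∀ j → crosses G f j ≡ true → j ∈ S
    kept j c with j ∈? S
    ... | yes j∈S = j∈S
    ... | no j∉S = contradiction (same-side j j∉S) (differ-true⇒≢ Bool._≟_ c)

Adm-resp-≗ : ∀ {v e} {G G′ : Graph v e} {m} → Adm G m → G ≗ G′ → Adm G′ m
Adm-resp-≗ {G′ = G′} (done G) G≗G′ = subst (Adm G′) (sym same-links) (done G′)
  where
  same-links : nonLoops G ≡ nonLoops G′
  same-links = trans (nonLoops-links G) (trans (cong ∣_∣ (tabulate-cong λ j →
      cong₂ (differ _≟_) (cong proj₁ (G≗G′ j)) (cong proj₂ (G≗G′ j))))
    (sym (nonLoops-links G′)))
Adm-resp-≗ {G′ = G′} (step G i ne adm) G≗G′ =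
  step G′ i ne′ (Adm-resp-≗ adm (contract-resp-≗ i ne ne′ G≗G′))
  where
  ne′ : Link G′ i
  ne′ s≡t = ne (trans (cong proj₁ (G≗G′ i)) (trans s≡t (sym (cong proj₂ (G≗G′ i)))))

admissible? : ∀ {v e} (G : Graph v e) → Decidable (Adm G)
admissible? {ℕ.zero} G m = no λ ()
admissible? {suc ℕ.zero} G m = no λ ()
admissible? {suc (suc ℕ.zero)} G m with m ℕ.≟ nonLoops G
... | yes refl = yes (done G)
... | no m≢ = no λ { (done _) → m≢ refl }
admissible? {suc (suc (suc n))} {ℕ.zero} G m = no λ ()
admissible? {suc (suc (suc n))} {suc e} G m with any? contractible?
  where
  contractible? : ∀ i → Dec (Σ (Link G i) λ ne → Adm (contract G i ne) m)
  contractible? i with src G i ≟ tgt G i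
  ... | yes s≡t = no λ (ne , _) → ne s≡t
  ... | no ne with admissible? (contract G i ne) m
  ...   | yes adm = yes (ne , adm)
  ...   | no ¬adm = no λ (ne′ , adm) →
            ¬adm (Adm-resp-≗ adm (contract-resp-≗ {G = G} i ne′ ne (λ _ → refl)))
... | yes (i , ne , adm) = yes (step G i ne adm)
... | no none = no λ { (step _ i ne adm) → none (i , ne , adm) }

least : ∀ {P : ℕ → Set} → Decidable P → ∀ {b} → P b → Σ ℕ (IsMin P)
least {P} P? {b} pb = search b 0 refl (λ _ ())
  where
  -- invariant: no j < k satisfies P, and k + fuel is the known witness b
  search : ∀ fuel k → k + fuel ≡ b → (∀ j → j < k → ¬ P j) → Σ ℕ (IsMin P)
  search fuel k _ below with P? k
  ... | yes pk = k , pk , λ j pj → ≮⇒≥ λ j<k → below j j<k pj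
  search ℕ.zero k k≡b below | no ¬pk =
    contradiction (subst P (trans (sym k≡b) (+-identityʳ k)) pb) ¬pk
  search (suc fuel) k k+1+fuel≡b below | no ¬pk =
    search fuel (suc k) (trans (sym (+-suc k fuel)) k+1+fuel≡b) below′
    where
    below′ : ∀ j → j < suc k → ¬ P j
    below′ j j<1+k with m<1+n⇒m<n∨m≡n j<1+k
    ... | inj₁ j<k = below j j<k
    ... | inj₂ refl = ¬pk

least-contraction≤disconnecting : ∀ {n e} (G : Graph (suc (suc n)) e) → Connected G →
  ∀ {k} → (∀ m → Adm G m → k ≤ m) → ∀ {j} → DisconnectingOfSize G j → k ≤ j
least-contraction≤disconnecting G conn {k} k≤adm (S , refl , disc) =
  decidable-stable (k ≤? ∣ S ∣) (¬¬-map bound (disconnecting⇒cut G S disc))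
  where
  bound : (Σ (Colouring _) λ f → Nonconstant f × cut G f ⊆ S) → k ≤ ∣ S ∣
  bound (f , nc , cut⊆S) with contraction≤cut G conn f nc
  ... | m , m≤cut , adm = ≤-trans (k≤adm m adm) (≤-trans m≤cut (p⊆q⇒∣p∣≤∣q∣ cut⊆S))

lemma6p2 : ∀ {v e} (G : Graph v e) → 2 ≤ v → Connected G →
    ∃[ k ] (IsMin (Adm G) k × IsMin (DisconnectingOfSize G) k)
lemma6p2 G (s≤s (s≤s _)) conn with contraction≤cut G conn c₀ c₀-nonconstant
... | _ , _ , adm with least (admissible? G) adm
... | k , adm-k , k≤adm =
  k , (adm-k , k≤adm) ,
  (contraction⇒disconnecting adm-k ,
   λ j disc → least-contraction≤disconnecting G conn k≤adm disc)
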